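{- (In $\mathbf{CZF}$.) For $u\in\mathbb N^{<\mathbb N}$: 1. Every $T\in\mathrm{BCov}(u)$ is countable. 2. If $T\in\mathrm{BCov}(u)$ and $(R_v)_{v\in T}$ is a family with $R_v\in\mathrm{BCov}(v)$ for each $v\in T$, then $\bigcup_{v\in T}R_v\in\mathrm{BCov}(u)$. 3. If $T\in\mathrm{BCov}(u)$ and $v\le u$, then there is $S\in\mathrm{BCov}(v)$ with $S\subseteq v^*({\downarrow}T)=\{w\le v:\exists t\in T,\ w\le t\}$.
   Context: $\mathbf{CZF}$ is Aczel's constructive Zermelo–Fraenkel set theory; countable means finite or in bijection with $\mathbb N$. $\mathbb N^{<\mathbb N}$ is ordered by $w\le v$ iff $v$ is an initial segment of $w$. $\mathrm{BCov}(\langle\,\rangle)$ is the smallest class of subsets of $\mathbb N^{<\mathbb N}$ with $\{\langle\,\rangle\}\in\mathrm{BCov}(\langle\,\rangle)$ and $\bigcup_{i\in\mathbb N}\langle i\rangle*S_i\in\mathrm{BCov}(\langle\,\rangle)$ whenever all $S_i\in\mathrm{BCov}(\langle\,\rangle)$ (with $\langle i\rangle*S=\{\langle i\rangle*s:s\in S\}$). For general $u$, $\mathrm{BCov}(u)=\{u*T:T\in\mathrm{BCov}(\langle\,\rangle)\}$, where $u*T=\{u*t:t\in T\}$. -}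

module Defs where

open import Data.Nat using (ℕ)
open import Data.Fin using (Fin)
open import Data.List using (List; []; _∷_; _++_)
open import Data.Product using (Σ; _×_; ∃)
open import Data.Sum using (_⊎_)
open import Relation.Binary.PropositionalEquality using (_≡_)
open import Function.Bundles using (_⇔_)
open import Function.Definitions using (Injective)

Seq : Set
Seq = List ℕ

Subset : Set₁
Subset = Seq → Set

-- w ≤ v  iff  v is an initial segment of w
_≼_ : Seq → Seq → Set
w ≼ v = Σ Seq λ r → w ≡ v ++ r

_≐_ : Subset → Subset → Set
S ≐ T = ∀ w → S w ⇔ T w

_⊆_ : Subset → Subset → Set
S ⊆ T = ∀ w → S w → T w

_⋆_ : Seq → Subset → Subset
(u ⋆ T) w = Σ Seq λ t → T t × w ≡ u ++ t

root : Subset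
root w = w ≡ []

⋃ℕ : (ℕ → Subset) → Subset
⋃ℕ S w = Σ ℕ λ i → ((i ∷ []) ⋆ S i) w

-- BCov(⟨⟩): the smallest class of subsets (closed under extensional
-- equality, as sets are extensional) containing {⟨⟩} and closed under
-- ⋃_{i} ⟨i⟩ * S_i.
data BCov₀ : Subset → Set₁ where
  leaf : ∀ {S} → S ≐ root → BCov₀ S
  node : ∀ {S} (F : ℕ → Subset) → (∀ i → BCov₀ (F i)) → S ≐ ⋃ℕ F → BCov₀ S

BCov : Seq → Subset → Set₁
BCov u T = Σ Subset λ T' → BCov₀ T' × (T ≐ (u ⋆ T'))

Enumerates : (I : Set) → (I → Seq) → Subset → Set
Enumerates I f T = (∀ i → T (f i)) × Injective _≡_ _≡_ f × (∀ w → T w → Σ I λ i → f i ≡ w)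

Countable : Subset → Set
Countable T = (Σ ℕ λ n → Σ (Fin n → Seq) λ f → Enumerates (Fin n) f T)
            ⊎ (Σ (ℕ → Seq) λ f → Enumerates ℕ f T)

⋃over : Subset → (Seq → Subset) → Subset
⋃over T R w = Σ Seq λ v → T v × R v w

down : Seq → Subset → Subset
down v T w = (w ≼ v) × (Σ Seq λ t → T t × w ≼ t)

-- A cover is a
-- singleton or a disjoint union, over i ∈ ℕ, of the nonempty covers ⟨i⟩ * Sᵢ,
-- hence countable. Grafting covers R_v onto the points v of a cover follows the
-- same derivation, since the union over v commutes with ⟨i⟩ * and with ⋃ᵢ. To restrict a cover of u
-- to v = u * r, follow r down the derivation: if it reaches a node exactly, that
-- subcover lies below T; if it runs into a leaf, the singleton {v} does.

module Submission where

open import Defs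
open import Data.Bool using (Bool; true; false)
open import Data.Empty using (⊥)
open import Data.Fin.Properties using (1↔⊤)
open import Data.List using ([]; _∷_; _++_)
open import Data.List.Properties using (∷-injectiveˡ; ∷-injectiveʳ; ++-assoc; ++-identityʳ; ++-cancelˡ)
open import Data.Nat using (ℕ; zero; suc; _+_)
open import Data.Nat.Properties using (+-suc; +-identityʳ; +-comm; suc-injective)
open import Data.Product using (Σ; _×_; _,_; proj₁; proj₂)
open import Data.Product.Function.Dependent.Propositional using (Σ-↔)
open import Data.Sum using (_⊎_; inj₁; inj₂; [_,_])
open import Data.Sum.Algebra using () renaming (⊎-cong to _⊎↔_)
open import Data.Unit using (⊤; tt)
open import Function using (_∘_; id)
open import Function.Bundles using (mk⇔; Equivalence; _↔_; Inverse; Injection; mk↔ₛ′)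
open import Function.Construct.Composition using (_⇔-∘_)
open import Function.Construct.Identity using (⇔-id)
open import Function.Properties.Inverse using (↔-refl; ↔-sym; ↔-trans; ↔⇒↣)
open import Function.Related.Propositional using (module EquationalReasoning)
open import Relation.Binary.PropositionalEquality using (_≡_; refl; sym; trans; cong; subst)

open Equivalence using (to; from)

parity : ℕ → ℕ ⊎ ℕ
parity zero    = inj₁ zero
parity (suc n) = [ inj₂ , inj₁ ∘ suc ] (parity n)

double : ℕ ⊎ ℕ → ℕ
double = [ (λ k → k + k) , (λ k → suc (k + k)) ]

double-parity : ∀ n → double (parity n) ≡ n
double-parity zero    = refl
double-parity (suc n) with parity n | double-parity n
... | inj₁ k | refl = refl
... | inj₂ k | refl = cong suc (+-suc k k)

parity-even : ∀ k → parity (k + k) ≡ inj₁ k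
parity-even zero    = refl
parity-even (suc k) rewrite +-suc k k | parity-even k = refl

parity-double : ∀ x → parity (double x) ≡ x
parity-double (inj₁ k) = parity-even k
parity-double (inj₂ k) rewrite parity-even k = refl

ℕ⊎ℕ↔ℕ : (ℕ ⊎ ℕ) ↔ ℕ
ℕ⊎ℕ↔ℕ = mk↔ₛ′ double parity double-parity parity-double

-- Cantor's enumeration of ℕ × ℕ along the antidiagonals
triangle : ℕ → ℕ
triangle zero    = zero
triangle (suc n) = suc n + triangle n

pair : ℕ × ℕ → ℕ
pair (i , k) = triangle (i + k) + i

next : ℕ × ℕ → ℕ × ℕ
next (i , zero)  = zero , suc i
next (i , suc k) = suc i , k

unpair : ℕ → ℕ × ℕ
unpair zero    = zero , zero
unpair (suc n) = next (unpair n)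

pair-next : ∀ p → pair (next p) ≡ suc (pair p)
pair-next (i , zero) rewrite +-identityʳ i | +-identityʳ (i + triangle i) = cong suc (+-comm i (triangle i))
pair-next (i , suc k) rewrite +-suc i k = +-suc (triangle (suc (i + k))) i

pair-unpair : ∀ n → pair (unpair n) ≡ n
pair-unpair zero    = refl
pair-unpair (suc n) = trans (pair-next (unpair n)) (cong suc (pair-unpair n))

-- Induction on the code: every p ≠ (0, 0) is the next of a pair with code one less.
unpair-pair : ∀ n p → pair p ≡ n → unpair n ≡ p
unpair-pair zero    (zero , zero)  _ = refl
unpair-pair (suc n) (zero , suc i) e =
  cong next (unpair-pair n (i , zero) (suc-injective (trans (sym (pair-next (i , zero))) e)))
unpair-pair (suc n) (suc i , k)    e =
  cong next (unpair-pair n (i , suc k) (suc-injective (trans (sym (pair-next (i , suc k))) e)))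

ℕ×ℕ↔ℕ : (ℕ × ℕ) ↔ ℕ
ℕ×ℕ↔ℕ = mk↔ₛ′ pair unpair pair-unpair (λ p → unpair-pair (pair p) p refl)

⊤⊎ℕ↔ℕ : (⊤ ⊎ ℕ) ↔ ℕ
⊤⊎ℕ↔ℕ = mk↔ₛ′ [ (λ _ → zero) , suc ] predecessor (λ { zero → refl ; (suc n) → refl })
                                                 (λ { (inj₁ tt) → refl ; (inj₂ n) → refl })
  where
  predecessor : ℕ → ⊤ ⊎ ℕ
  predecessor zero    = inj₁ tt
  predecessor (suc n) = inj₂ n

Σ-distrib-⊎ : {I : Set} {A B : I → Set} → Σ I (λ i → A i ⊎ B i) ↔ (Σ I A ⊎ Σ I B)
Σ-distrib-⊎ = mk↔ₛ′
  (λ { (i , inj₁ a) → inj₁ (i , a) ; (i , inj₂ b) → inj₂ (i , b) })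
  (λ { (inj₁ (i , a)) → i , inj₁ a ; (inj₂ (i , b)) → i , inj₂ b })
  (λ { (inj₁ _) → refl ; (inj₂ _) → refl })
  (λ { (_ , inj₁ _) → refl ; (_ , inj₂ _) → refl })

⊎-⊥↔ : (A : Set) → (A ⊎ ⊥) ↔ A
⊎-⊥↔ _ = mk↔ₛ′ [ id , (λ ()) ] inj₁ (λ _ → refl) (λ { (inj₁ _) → refl ; (inj₂ ()) })

ℕ-if : Bool → Set
ℕ-if true  = ℕ
ℕ-if false = ⊥

ℕ⊎ℕ-if↔ℕ : ∀ b → (ℕ ⊎ ℕ-if b) ↔ ℕ
ℕ⊎ℕ-if↔ℕ true  = ℕ⊎ℕ↔ℕ
ℕ⊎ℕ-if↔ℕ false = ⊎-⊥↔ ℕ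

-- Hilbert's hotel: the distinguished points, one per fibre, form a copy of
-- ℕ ≅ ℕ × ℕ, which gives each fibre a copy of ℕ to absorb the rest of it.
Σ-⊤⊎ℕ-if↔ℕ : (c : ℕ → Bool) → Σ ℕ (λ i → ⊤ ⊎ ℕ-if (c i)) ↔ ℕ
Σ-⊤⊎ℕ-if↔ℕ c = begin
  Σ ℕ (λ i → ⊤ ⊎ ℕ-if (c i))      ↔⟨ Σ-distrib-⊎ ⟩
  (ℕ × ⊤ ⊎ Σ ℕ (ℕ-if ∘ c))       ↔⟨ ↔-trans ℕ×⊤↔ℕ (↔-sym ℕ×ℕ↔ℕ) ⊎↔ ↔-refl ⟩
  (ℕ × ℕ ⊎ Σ ℕ (ℕ-if ∘ c))       ↔⟨ Σ-distrib-⊎ ⟨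
  Σ ℕ (λ i → ℕ ⊎ ℕ-if (c i))      ↔⟨ Σ-↔ ↔-refl (ℕ⊎ℕ-if↔ℕ (c _)) ⟩
  (ℕ × ℕ)                         ↔⟨ ℕ×ℕ↔ℕ ⟩
  ℕ                               ∎
  where
  open EquationalReasoning
  ℕ×⊤↔ℕ : (ℕ × ⊤) ↔ ℕ
  ℕ×⊤↔ℕ = mk↔ₛ′ proj₁ (_, tt) (λ _ → refl) (λ _ → refl)

≐-refl : {S : Subset} → S ≐ S
≐-refl w = ⇔-id _

≐-trans : {S T U : Subset} → S ≐ T → T ≐ U → S ≐ U
≐-trans e e′ w = e′ w ⇔-∘ e w

≼-refl : ∀ w → w ≼ w
≼-refl w = [] , sym (++-identityʳ w)

≼-trans : ∀ {w v u} → w ≼ v → v ≼ u → w ≼ u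
≼-trans {u = u} (r , refl) (s , refl) = s ++ r , ++-assoc u s r

_⋆⁻¹_ : Seq → Subset → Subset
(u ⋆⁻¹ S) w = S (u ++ w)

[]⋆ : {S : Subset} → ([] ⋆ S) ≐ S
[]⋆ w = mk⇔ (λ { (_ , s , refl) → s }) (λ s → w , s , refl)

BCov₀-resp-≐ : ∀ {S S′} → S ≐ S′ → BCov₀ S′ → BCov₀ S
BCov₀-resp-≐ e (leaf e′)       = leaf (≐-trans e e′)
BCov₀-resp-≐ e (node F bF e′) = node F bF (≐-trans e e′)

BCov-≼ : ∀ {v S} → BCov v S → S ⊆ (_≼ v)
BCov-≼ (_ , _ , e) w s with to (e w) s
... | t , _ , p = t , p

BCov-⋆⁻¹ : ∀ u {t S} → BCov (u ++ t) S → BCov t (u ⋆⁻¹ S)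
BCov-⋆⁻¹ u {t} (Q , bQ , e) = Q , bQ , λ w → mk⇔
  (λ s → let (r , q , p) = to (e (u ++ w)) s in r , q , ++-cancelˡ u _ _ (trans p (++-assoc u t r)))
  (λ { (r , q , refl) → from (e (u ++ w)) (r , q , sym (++-assoc u t r)) })

⋃over-congˡ : ∀ {T T′ R} → T ≐ T′ → ⋃over T R ≐ ⋃over T′ R
⋃over-congˡ e w = mk⇔ (λ { (v , t , r) → v , to (e v) t , r }) (λ { (v , t , r) → v , from (e v) t , r })

⋃over-root : ∀ {R} → ⋃over root R ≐ R []
⋃over-root w = mk⇔ (λ { (_ , refl , r) → r }) (λ r → [] , refl , r)

⋃over-⋆ : ∀ u {T R} → (∀ t → T t → R (u ++ t) ⊆ (_≼ (u ++ t))) →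
          ⋃over (u ⋆ T) R ≐ (u ⋆ ⋃over T (λ t → u ⋆⁻¹ R (u ++ t)))
⋃over-⋆ u {T} {R} R-ext w = mk⇔ (⇒ w) ⇐
  where
  ⇒ : ∀ w → ⋃over (u ⋆ T) R w → (u ⋆ ⋃over T (λ t → u ⋆⁻¹ R (u ++ t))) w
  ⇒ w (_ , (t , Tt , refl) , r) with ≼-trans (R-ext t Tt w r) (t , refl)
  ... | x , refl = x , (t , Tt , r) , refl
  ⇐ : (u ⋆ ⋃over T (λ t → u ⋆⁻¹ R (u ++ t))) w → ⋃over (u ⋆ T) R w
  ⇐ (_ , (t , Tt , r) , refl) = u ++ t , (t , Tt , refl) , r

⋃over-⋃ℕ : ∀ {F R} → (∀ v → ⋃ℕ F v → R v ⊆ (_≼ v)) →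
           ⋃over (⋃ℕ F) R ≐ ⋃ℕ (λ i → ⋃over (F i) (λ t → (i ∷ []) ⋆⁻¹ R (i ∷ t)))
⋃over-⋃ℕ {F} {R} R-ext w = mk⇔
  (λ { (v , (i , Fv) , r) → i , to (union i w) (v , Fv , r) })
  (λ { (i , x) → let (v , Fv , r) = from (union i w) x in v , (i , Fv) , r })
  where
  union : ∀ i → ⋃over ((i ∷ []) ⋆ F i) R ≐ ((i ∷ []) ⋆ ⋃over (F i) (λ t → (i ∷ []) ⋆⁻¹ R (i ∷ t)))
  union i = ⋃over-⋆ (i ∷ []) {R = R} (λ t Ft → R-ext (i ∷ t) (i , t , Ft , refl))

BCov₀-⋃over : ∀ {T R} → BCov₀ T → (∀ v → T v → BCov v (R v)) → BCov₀ (⋃over T R)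
BCov₀-⋃over (leaf e) bR =
  let (Q , bQ , e′) = bR [] (from (e []) refl) in
  BCov₀-resp-≐ (≐-trans (⋃over-congˡ e) (≐-trans ⋃over-root (≐-trans e′ []⋆))) bQ
BCov₀-⋃over (node F bF e) bR = node _
  (λ i → BCov₀-⋃over (bF i) (λ t Ft → BCov-⋆⁻¹ (i ∷ []) (bR (i ∷ t) (from (e _) (i , t , Ft , refl)))))
  (≐-trans (⋃over-congˡ e) (⋃over-⋃ℕ (λ v F∋v → BCov-≼ (bR v (from (e v) F∋v)))))

BCov-⋃over : ∀ {u T R} → BCov u T → (∀ v → T v → BCov v (R v)) → BCov u (⋃over T R)
BCov-⋃over {u} {T} (T′ , bT′ , e) bR =
  _ , BCov₀-⋃over bT′ (λ t T′t → BCov-⋆⁻¹ u (bR (u ++ t) (T∋ t T′t))) ,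
  ≐-trans (⋃over-congˡ e) (⋃over-⋆ u (λ t T′t → BCov-≼ (bR (u ++ t) (T∋ t T′t))))
  where
  T∋ : ∀ t → T′ t → T (u ++ t)
  T∋ t T′t = from (e (u ++ t)) (t , T′t , refl)

↓_ : Subset → Subset
(↓ T) w = Σ Seq λ t → T t × w ≼ t

≼-++⁺ : ∀ u {w t} → w ≼ t → (u ++ w) ≼ (u ++ t)
≼-++⁺ u {t = t} (z , refl) = z , sym (++-assoc u t z)

↓-⋆ : ∀ {u T T′ w} → T ≐ (u ⋆ T′) → (↓ T′) w → (↓ T) (u ++ w)
↓-⋆ {u} e (t , T′t , w≼t) = u ++ t , from (e (u ++ t)) (t , T′t , refl) , ≼-++⁺ u w≼t

BCov₀-restrict : ∀ {T} → BCov₀ T → ∀ r → Σ Subset λ S → BCov₀ S × (r ⋆ S) ⊆ (↓ T)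
BCov₀-restrict (leaf e) r = root , leaf ≐-refl , λ { _ (_ , refl , refl) → [] , from (e []) refl , r ++ [] , refl }
BCov₀-restrict bT@(node _ _ _) [] = _ , bT , λ { _ (x , Tx , refl) → x , Tx , ≼-refl x }
BCov₀-restrict (node F bF e) (i ∷ r) =
  let (S , bS , S↓) = BCov₀-restrict (bF i) r in
  S , bS , λ { _ (x , Sx , refl) →
    let (t , Ft , r++x≼t) = S↓ (r ++ x) (x , Sx , refl) in
    i ∷ t , from (e (i ∷ t)) (i , t , Ft , refl) , ≼-++⁺ (i ∷ []) r++x≼t }

BCov-restrict : ∀ {u T} → BCov u T → ∀ v → v ≼ u → Σ Subset λ S → BCov v S × S ⊆ down v T
BCov-restrict {u} {T} (T′ , bT′ , e) v (r , refl) =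
  let (S , bS , S↓) = BCov₀-restrict bT′ r in
  v ⋆ S , (S , bS , ≐-refl) , λ { _ (x , Sx , refl) →
    (x , refl) , subst (↓ T) (sym (++-assoc u r x)) (↓-⋆ e (S↓ (r ++ x) (x , Sx , refl))) }

Enumerates-↔ : ∀ {I J f T} (e : I ↔ J) → Enumerates J f T → Enumerates I (f ∘ Inverse.to e) T
Enumerates-↔ {f = f} e (f∈ , f-inj , f-onto) =
  f∈ ∘ Inverse.to e ,
  (λ p → Injection.injective (↔⇒↣ e) (f-inj p)) ,
  λ w Tw → let (j , p) = f-onto w Tw in Inverse.from e j , trans (cong f (Inverse.strictlyInverseˡ e j)) p

Enumerates-≐ : ∀ {I f S T} → S ≐ T → Enumerates I f T → Enumerates I f S
Enumerates-≐ e (f∈ , f-inj , f-onto) = (λ i → from (e _) (f∈ i)) , f-inj , λ w Sw → f-onto w (to (e w) Sw)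

Enumerates-⋆ : ∀ u {I f T} → Enumerates I f T → Enumerates I ((u ++_) ∘ f) (u ⋆ T)
Enumerates-⋆ u {f = f} (f∈ , f-inj , f-onto) =
  (λ i → f i , f∈ i , refl) ,
  (λ p → f-inj (++-cancelˡ u _ _ p)) ,
  λ { _ (t , Tt , refl) → let (i , p) = f-onto t Tt in i , cong (u ++_) p }

Enumerates-⋃ℕ : ∀ {I : ℕ → Set} {f : ∀ i → I i → Seq} {F} → (∀ i → Enumerates (I i) (f i) (F i)) →
                Enumerates (Σ ℕ I) (λ (i , x) → i ∷ f i x) (⋃ℕ F)
Enumerates-⋃ℕ {I} {f} en = (λ (i , x) → i , f i x , proj₁ (en i) x , refl) , injective , onto
  where
  injective : ∀ {p q : Σ ℕ I} → proj₁ p ∷ f (proj₁ p) (proj₂ p) ≡ proj₁ q ∷ f (proj₁ q) (proj₂ q) → p ≡ q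
  injective {i , x} {j , y} eq with ∷-injectiveˡ eq
  ... | refl with proj₁ (proj₂ (en i)) (∷-injectiveʳ eq)
  ... | refl = refl
  onto : ∀ w → ⋃ℕ _ w → Σ (Σ ℕ I) λ (i , x) → i ∷ f i x ≡ w
  onto _ (i , t , Ft , refl) = let (x , p) = proj₂ (proj₂ (en i)) t Ft in (i , x) , cong (i ∷_) p

-- A cover is a singleton or countably infinite; carrying the distinguished point
-- in the index type is what makes the node case a bijection.
BCov₀-enumerable : ∀ {T} → BCov₀ T → Σ Bool λ b → Σ (⊤ ⊎ ℕ-if b → Seq) λ f → Enumerates (⊤ ⊎ ℕ-if b) f T
BCov₀-enumerable (leaf e) =
  false , (λ _ → []) ,
  Enumerates-≐ e ( (λ _ → refl)
                 , (λ { {inj₁ tt} {inj₁ tt} _ → refl ; {inj₂ ()} ; {_} {inj₂ ()} })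
                 , λ { _ refl → inj₁ tt , refl })
BCov₀-enumerable (node F bF e) =
  true , _ ,
  Enumerates-↔ (↔-trans ⊤⊎ℕ↔ℕ (↔-sym (Σ-⊤⊎ℕ-if↔ℕ (proj₁ ∘ enumeration))))
               (Enumerates-≐ e (Enumerates-⋃ℕ (proj₂ ∘ proj₂ ∘ enumeration)))
  where
  enumeration : ∀ i → Σ Bool λ b → Σ (⊤ ⊎ ℕ-if b → Seq) λ f → Enumerates (⊤ ⊎ ℕ-if b) f (F i)
  enumeration i = BCov₀-enumerable (bF i)

BCov-countable : ∀ {u T} → BCov u T → Countable T
BCov-countable {u} (T′ , bT′ , e) with BCov₀-enumerable bT′
... | false , _ , en = inj₁ (1 , _ , Enumerates-≐ e (Enumerates-⋆ u (Enumerates-↔ (↔-trans 1↔⊤ (↔-sym (⊎-⊥↔ ⊤))) en)))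
... | true  , _ , en = inj₂ (_ , Enumerates-≐ e (Enumerates-⋆ u (Enumerates-↔ (↔-sym ⊤⊎ℕ↔ℕ) en)))

lemmaB3 : (u : Seq) →
    ((T : Subset) → BCov u T → Countable T)
    × ((T : Subset) → BCov u T → (R : Seq → Subset) → ((v : Seq) → T v → BCov v (R v)) → BCov u (⋃over T R))
    × ((T : Subset) → BCov u T → (v : Seq) → v ≼ u → Σ Subset λ S → BCov v S × S ⊆ down v T)
lemmaB3 u = (λ _ → BCov-countable) , (λ _ bT _ → BCov-⋃over bT) , (λ _ → BCov-restrict)
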